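{- Let $q=2$, $d\geq 1$, $n\geq 2d+1$, $0\leq i\leq d-1$, $1\leq j\leq d$, $h=\min\{i,d-j\}$ and $h'=\min\{i+1,d-j\}$. Then $\frac{|T_h(i,j)|}{|T_{h'}(i+1,j)|}\geq l$, where (i) $l=3$ if $(n,h)\neq(2d+1,d-j)$ and $2\leq j\leq d$; (ii) $l=3/2$ if $(n,h)\neq(2d+1,d-j)$ and $j=1$; (iii) $l=6$ if $n=2d+1$ and $d-j<i$; (iv) $l=\dfrac{2^{j}(2^{d+1}-1)}{(2^{j}-1)(2^{d-j+1}-1)}$ if $n=2d+1$ and $d-j=i$.
   Context: For integers $N\geq 0$ and $k$, ${N \brack k}_2=\prod_{t=1}^{k}\frac{2^{N-k+t}-1}{2^t-1}$ if $0\leq k\leq N$, and $0$ if $k<0$ or $k>N$. For $0\le i,j\le d$ and $h\geq 0$, $T_h(i,j)=(-1)^{i-h}2^{j(j-i+h)+\binom{i-h}{2}}{i \brack h}_2{d-h \brack j}_2{n-d-i+h \brack n-d-j}_2$. -}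

module Defs where

open import Data.Nat as N using (ℕ; zero; suc; _+_; _∸_; _≤ᵇ_; NonZero)
open import Data.Nat.Combinatorics using (_C_)
open import Data.Bool using (if_then_else_)
open import Data.Integer using (+_)
open import Data.Rational using (ℚ; _/_; _*_; -_; 1ℚ; 0ℚ)

pow2m1-nonzero : ∀ t → NonZero (2 N.^ suc t ∸ 1)
pow2m1-nonzero zero = _
pow2m1-nonzero (suc t) = N.>-nonZero (lem t)
  where
  open import Data.Nat.Properties
  lem : ∀ t → 0 N.< 2 N.^ suc (suc t) ∸ 1
  lem t = m<n⇒0<n∸m {1} (begin-strict 1 <⟨ N.s≤s (N.s≤s N.z≤n) ⟩ 2 ≤⟨ ^-monoʳ-≤ 2 {1} {suc (suc t)} (N.s≤s N.z≤n) ⟩ 2 N.^ suc (suc t) ∎)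
    where open ≤-Reasoning

_^ℚ_ : ℚ → ℕ → ℚ
x ^ℚ zero = 1ℚ
x ^ℚ suc m = x * (x ^ℚ m)

factor : ℕ → ℕ → ℕ → ℚ
factor N k t' = _/_ (+ (2 N.^ (N ∸ k + suc t') ∸ 1)) (2 N.^ suc t' ∸ 1) {{pow2m1-nonzero t'}}

prodFactors : ℕ → ℕ → ℕ → ℚ
prodFactors N k zero = 1ℚ
prodFactors N k (suc m) = prodFactors N k m * factor N k m

gauss2 : ℕ → ℕ → ℚ
gauss2 N k = if k ≤ᵇ N then prodFactors N k k else 0ℚ

-- T_h(i,j) for parameters n, d (all differences are natural in the theorem's range)
T : (n d h i j : ℕ) → ℚ
T n d h i j =
  ((- 1ℚ) ^ℚ (i ∸ h)) * ((_/_ (+ 2) 1 ^ℚ (j N.* (j + h ∸ i) + (i ∸ h) C 2))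
    * (gauss2 i h * (gauss2 (d ∸ h) j * gauss2 (n ∸ d ∸ i + h) (n ∸ d ∸ j))))

-- the bound in case (iv): 2^j (2^(d+1) - 1) / ((2^j - 1)(2^(d-j+1) - 1)), for j ≥ 1
-- (value at j = 0 is irrelevant and set to 0)
lIV : (d j : ℕ) → ℚ
lIV d zero = 0ℚ
lIV d (suc j′) =
  (_/_ (+ (2 N.^ suc j′ N.* (2 N.^ (d + 1) ∸ 1))) (2 N.^ suc j′ ∸ 1) {{pow2m1-nonzero j′}})
  * (_/_ (+ 1) (2 N.^ suc (d ∸ suc j′) ∸ 1) {{pow2m1-nonzero (d ∸ suc j′)}})

-- If i + 1 ≤ d − j, then h = i and h′ = i + 1, the signs and powers of 2 of the two terms agree, and the
-- quotient |T_i(i,j)| / |T_{i+1}(i+1,j)| collapses to [d−i, j]_2 / [d−i−1, j]_2 = (2^{d−i} − 1)/(2^{d−i−j} − 1),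
-- which is at least 3 for j ≥ 2 and at least 3/2 for j = 1; cases (iii) and (iv) cannot occur.
-- Otherwise h = h′ = d − j, and writing i = h + a, j = a + 1 + b, n = 2d + 1 + e the quotient is
--   2^{b+1} (2^{a+1} − 1)(2^{b+h+e+2} − 1) / ((2^{a+h+1} − 1)(2^{b+1} − 1)).
-- The bounds (i)–(iii) are then polynomial inequalities in the powers of two (e ≥ 1 in (i), (ii) and a ≥ 1
-- in (iii)), and (iv), where a = e = 0, is an equality.  Gaussian binomials enter through
-- [c + m, m]_2 = ∏_{t=1}^m (2^{c+t} − 1) / ∏_{t=1}^m (2^t − 1), so every comparison of rationals becomes a
-- cross-multiplied inequality of natural numbers.

{-# OPTIONS --safe #-}
module Submission where

open import Defs
open import Data.Bool using (true)
open import Data.Nat using (_≤ᵇ_; ℕ; zero; suc; pred; _+_; _∸_; _^_; _*_; _≤_; _<_; _⊓_; s≤s; z≤n; NonZero; _≤?_)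
import Data.Nat.Properties as ℕ
open import Data.Nat.Combinatorics using (_C_; nCk+nC[k+1]≡[n+1]C[k+1]; nC1≡n)
open import Data.Nat.Tactic.RingSolver using (solve-∀)
open import Data.Integer using (+_; +≤+) renaming (_*_ to _*ℤ_; _≤_ to _≤ℤ_)
import Data.Integer.Properties as ℤ
open import Data.Rational using (ℚ; _/_; ∣_∣; 1ℚ; -_; toℚᵘ) renaming (_≤_ to _≤ℚ_; _*_ to _*ℚ_)
import Data.Rational.Properties as ℚ
open import Data.Rational.Unnormalised using (mkℚᵘ; *≤*) renaming (_≃_ to _≃ᵘ_; _*_ to _*ᵘ_)
import Data.Rational.Unnormalised.Properties as ℚᵘ
open import Data.Sum using (_⊎_; inj₁; inj₂)
open import Data.Product using (_×_; _,_; proj₁; proj₂)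
open import Data.Empty using (⊥-elim)
open import Relation.Nullary using (yes; no)
open import Relation.Binary.PropositionalEquality

frac : ℕ → (q : ℕ) → .{{NonZero q}} → ℚ
frac p q = + p / q

toℚᵘ-frac : ∀ p q .{{_ : NonZero q}} → toℚᵘ (frac p q) ≃ᵘ mkℚᵘ (+ p) (pred q)
toℚᵘ-frac p (suc q) = ℚ.toℚᵘ-fromℚᵘ (mkℚᵘ (+ p) q)

frac-* : ∀ a b c d .{{_ : NonZero b}} .{{_ : NonZero d}} →
         frac a b *ℚ frac c d ≡ frac (a * c) (b * d) {{ℕ.m*n≢0 b d}}
frac-* a (suc b) c (suc d) = ℚ.toℚᵘ-injective (begin
  toℚᵘ (frac a (suc b) *ℚ frac c (suc d))         ≈⟨ ℚ.toℚᵘ-homo-* (frac a (suc b)) (frac c (suc d)) ⟩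
  toℚᵘ (frac a (suc b)) *ᵘ toℚᵘ (frac c (suc d))  ≈⟨ ℚᵘ.*-cong (toℚᵘ-frac a (suc b)) (toℚᵘ-frac c (suc d)) ⟩
  mkℚᵘ (+ a *ℤ + c) (d + b * suc d)               ≡⟨ cong (λ z → mkℚᵘ z (d + b * suc d)) (sym (ℤ.pos-* a c)) ⟩
  mkℚᵘ (+ (a * c)) (d + b * suc d)                ≈⟨ toℚᵘ-frac (a * c) (suc b * suc d) ⟨
  toℚᵘ (frac (a * c) (suc b * suc d))             ∎)
  where open ℚᵘ.≃-Reasoning

frac-mono-≤ : ∀ a b c d .{{_ : NonZero b}} .{{_ : NonZero d}} → a * d ≤ c * b → frac a b ≤ℚ frac c d
frac-mono-≤ a (suc b) c (suc d) ad≤cb = ℚ.toℚᵘ-cancel-≤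
  (ℚᵘ.≤-respˡ-≃ (ℚᵘ.≃-sym (toℚᵘ-frac a (suc b))) (ℚᵘ.≤-respʳ-≃ (ℚᵘ.≃-sym (toℚᵘ-frac c (suc d)))
    (*≤* (subst₂ _≤ℤ_ (ℤ.pos-* a (suc d)) (ℤ.pos-* c (suc b)) (+≤+ ad≤cb)))))

∣frac∣ : ∀ a b .{{_ : NonZero b}} → ∣ frac a b ∣ ≡ frac a b
∣frac∣ a b = ℚ.0≤p⇒∣p∣≡p (ℚ.nonNegative⁻¹ (frac a b) {{ℚ.normalize-nonNeg a b}})

frac-cross-≤ : ∀ l m p q p′ q′ .{{_ : NonZero m}} .{{_ : NonZero q}} .{{_ : NonZero q′}} →
               l * p′ * q ≤ p * (m * q′) → frac l m *ℚ frac p′ q′ ≤ℚ frac p q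
frac-cross-≤ l m p q p′ q′ cross = subst (_≤ℚ frac p q) (sym (frac-* l m p′ q′))
  (frac-mono-≤ (l * p′) (m * q′) p q {{ℕ.m*n≢0 m q′}} cross)

nonZero-*³ : ∀ a b c .{{_ : NonZero a}} .{{_ : NonZero b}} .{{_ : NonZero c}} → NonZero (a * (b * c))
nonZero-*³ (suc a) b c = ℕ.m*n≢0 (suc a) (b * c) {{_}} {{ℕ.m*n≢0 b c}}

m≡k+n⇒m∸n≡k : ∀ {m n k} → m ≡ k + n → m ∸ n ≡ k
m≡k+n⇒m∸n≡k {n = n} {k} refl = ℕ.m+n∸n≡m k n

-- Gaussian binomials at q = 2

-- [c + m, m]_2 = mersenneProd c m / mersenneProd 0 m
mersenneProd : ℕ → ℕ → ℕ
mersenneProd c zero    = 1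
mersenneProd c (suc m) = mersenneProd c m * (2 ^ (c + suc m) ∸ 1)

2^[c+1+m]∸1≢0 : ∀ c m → NonZero (2 ^ (c + suc m) ∸ 1)
2^[c+1+m]∸1≢0 c m = subst (λ z → NonZero (2 ^ z ∸ 1)) (sym (ℕ.+-suc c m)) (pow2m1-nonzero (c + m))

mersenneProd≢0 : ∀ c m → NonZero (mersenneProd c m)
mersenneProd≢0 c zero    = _
mersenneProd≢0 c (suc m) = ℕ.m*n≢0 (mersenneProd c m) _ {{mersenneProd≢0 c m}} {{2^[c+1+m]∸1≢0 c m}}

prodFactors≡frac : ∀ N k m → prodFactors N k m ≡ frac (mersenneProd (N ∸ k) m) (mersenneProd 0 m) {{mersenneProd≢0 0 m}}
prodFactors≡frac N k zero    = refl
prodFactors≡frac N k (suc m) = trans (cong (_*ℚ factor N k m) (prodFactors≡frac N k m))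
  (frac-* (mersenneProd (N ∸ k) m) (mersenneProd 0 m) (2 ^ (N ∸ k + suc m) ∸ 1) (2 ^ suc m ∸ 1)
          {{mersenneProd≢0 0 m}} {{pow2m1-nonzero m}})

gauss2≡frac : ∀ {N} c k → N ≡ c + k → gauss2 N k ≡ frac (mersenneProd c k) (mersenneProd 0 k) {{mersenneProd≢0 0 k}}
gauss2≡frac c k refl with k ≤ᵇ c + k | ℕ.≤⇒≤ᵇ (ℕ.m≤n+m k c)
... | true | _ = trans (prodFactors≡frac (c + k) k k)
  (cong (λ z → frac (mersenneProd z k) (mersenneProd 0 k) {{mersenneProd≢0 0 k}}) (ℕ.m+n∸n≡m c k))

mersenneProd-shift : ∀ c m → mersenneProd (suc c) m * (2 ^ suc c ∸ 1) ≡ mersenneProd c m * (2 ^ (suc c + m) ∸ 1)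
mersenneProd-shift c zero    = cong (λ t → 1 * (2 ^ t ∸ 1)) (sym (ℕ.+-identityʳ (suc c)))
mersenneProd-shift c (suc m) = begin
  mersenneProd (suc c) m * v * u             ≡⟨ swap (mersenneProd (suc c) m) v u ⟩
  mersenneProd (suc c) m * u * v             ≡⟨ cong (_* v) (mersenneProd-shift c m) ⟩
  mersenneProd c m * (2 ^ (suc c + m) ∸ 1) * v ≡⟨ cong (λ t → mersenneProd c m * (2 ^ t ∸ 1) * v) (sym (ℕ.+-suc c m)) ⟩
  mersenneProd c m * (2 ^ (c + suc m) ∸ 1) * v ∎
  where
  open ≡-Reasoning
  u = 2 ^ suc c ∸ 1
  v = 2 ^ (suc c + suc m) ∸ 1
  swap : ∀ a b c → a * b * c ≡ a * c * b
  swap = solve-∀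

mersenneProd-ratio : ∀ l m c j → l * (2 ^ suc c ∸ 1) ≤ m * (2 ^ (suc c + j) ∸ 1) →
                     l * mersenneProd c j ≤ m * mersenneProd (suc c) j
mersenneProd-ratio l m c j ratio = ℕ.*-cancelʳ-≤ (l * x) (m * y) u {{pow2m1-nonzero c}} (begin
  l * x * u   ≡⟨ reorder₁ l x u ⟩
  x * (l * u) ≤⟨ ℕ.*-monoʳ-≤ x ratio ⟩
  x * (m * v) ≡⟨ reorder₂ x m v ⟩
  m * (x * v) ≡⟨ cong (m *_) (sym (mersenneProd-shift c j)) ⟩
  m * (y * u) ≡⟨ sym (ℕ.*-assoc m y u) ⟩
  m * y * u   ∎)
  where
  open ℕ.≤-Reasoning
  x = mersenneProd c j
  y = mersenneProd (suc c) j
  u = 2 ^ suc c ∸ 1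
  v = 2 ^ (suc c + j) ∸ 1
  reorder₁ : ∀ a b c → a * b * c ≡ b * (a * c)
  reorder₁ = solve-∀
  reorder₂ : ∀ a b c → a * (b * c) ≡ b * (a * c)
  reorder₂ = solve-∀

2^ℚ≡frac : ∀ e → frac 2 1 ^ℚ e ≡ frac (2 ^ e) 1
2^ℚ≡frac zero    = refl
2^ℚ≡frac (suc e) = trans (cong (frac 2 1 *ℚ_) (2^ℚ≡frac e)) (frac-* 2 1 (2 ^ e) 1)

∣-1^k∣≡1 : ∀ k → ∣ (- 1ℚ) ^ℚ k ∣ ≡ 1ℚ
∣-1^k∣≡1 zero    = refl
∣-1^k∣≡1 (suc k) = trans (ℚ.∣p*q∣≡∣p∣*∣q∣ (- 1ℚ) ((- 1ℚ) ^ℚ k)) (cong (∣ - 1ℚ ∣ *ℚ_) (∣-1^k∣≡1 k))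

∣T∣≡frac : ∀ n d h i j {e} p₁ q₁ p₂ q₂ p₃ q₃ .{{_ : NonZero q₁}} .{{_ : NonZero q₂}} .{{_ : NonZero q₃}} →
  j * (j + h ∸ i) + (i ∸ h) C 2 ≡ e →
  gauss2 i h ≡ frac p₁ q₁ → gauss2 (d ∸ h) j ≡ frac p₂ q₂ → gauss2 (n ∸ d ∸ i + h) (n ∸ d ∸ j) ≡ frac p₃ q₃ →
  ∣ T n d h i j ∣ ≡ frac (2 ^ e * (p₁ * (p₂ * p₃))) (q₁ * (q₂ * q₃)) {{nonZero-*³ q₁ q₂ q₃}}
∣T∣≡frac n d h i j {e} p₁ q₁ p₂ q₂ p₃ q₃ refl g₁ g₂ g₃ = begin
  ∣ (- 1ℚ) ^ℚ (i ∸ h) *ℚ R ∣          ≡⟨ ℚ.∣p*q∣≡∣p∣*∣q∣ ((- 1ℚ) ^ℚ (i ∸ h)) R ⟩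
  ∣ (- 1ℚ) ^ℚ (i ∸ h) ∣ *ℚ ∣ R ∣      ≡⟨ cong (_*ℚ ∣ R ∣) (∣-1^k∣≡1 (i ∸ h)) ⟩
  1ℚ *ℚ ∣ R ∣                         ≡⟨ ℚ.*-identityˡ ∣ R ∣ ⟩
  ∣ R ∣                               ≡⟨ cong ∣_∣ R≡frac ⟩
  ∣ frac (2 ^ e * p) q ∣              ≡⟨ ∣frac∣ (2 ^ e * p) q ⟩
  frac (2 ^ e * p) q                  ∎
  where
  open ≡-Reasoning
  R = frac 2 1 ^ℚ e *ℚ (gauss2 i h *ℚ (gauss2 (d ∸ h) j *ℚ gauss2 (n ∸ d ∸ i + h) (n ∸ d ∸ j)))
  p = p₁ * (p₂ * p₃)
  q = q₁ * (q₂ * q₃)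
  instance
    q≢0 : NonZero q
    q≢0 = nonZero-*³ q₁ q₂ q₃
    q₂*q₃≢0 : NonZero (q₂ * q₃)
    q₂*q₃≢0 = ℕ.m*n≢0 q₂ q₃
  R≡frac : R ≡ frac (2 ^ e * p) q
  R≡frac = begin
    R                                                        ≡⟨ cong₂ _*ℚ_ (2^ℚ≡frac e) (cong₂ _*ℚ_ g₁ (cong₂ _*ℚ_ g₂ g₃)) ⟩
    frac (2 ^ e) 1 *ℚ (frac p₁ q₁ *ℚ (frac p₂ q₂ *ℚ frac p₃ q₃)) ≡⟨ cong (λ z → frac (2 ^ e) 1 *ℚ (frac p₁ q₁ *ℚ z)) (frac-* p₂ q₂ p₃ q₃) ⟩
    frac (2 ^ e) 1 *ℚ (frac p₁ q₁ *ℚ frac (p₂ * p₃) (q₂ * q₃)) ≡⟨ cong (frac (2 ^ e) 1 *ℚ_) (frac-* p₁ q₁ (p₂ * p₃) (q₂ * q₃)) ⟩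
    frac (2 ^ e) 1 *ℚ frac p q                                ≡⟨ frac-* (2 ^ e) 1 p q ⟩
    frac (2 ^ e * p) (1 * q) {{ℕ.m*n≢0 1 q}}                 ≡⟨ ℚ./-cong {+ (2 ^ e * p)} {_} {+ (2 ^ e * p)} {{ℕ.m*n≢0 1 q}} refl (ℕ.*-identityˡ q) ⟩
    frac (2 ^ e * p) q                                        ∎

-- The case i < d − j, where h = i

∣T[i,i]∣≡frac : ∀ n d i j c → i ≤ n ∸ d → j ≤ n ∸ d → d ∸ i ≡ c + j →
  let K = n ∸ d ∸ j in
  ∣ T n d i i j ∣ ≡ frac (2 ^ (j * j) * (mersenneProd 0 i * (mersenneProd c j * mersenneProd j K)))
                         (mersenneProd 0 i * (mersenneProd 0 j * mersenneProd 0 K))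
                         {{nonZero-*³ _ _ _ {{mersenneProd≢0 0 i}} {{mersenneProd≢0 0 j}} {{mersenneProd≢0 0 K}}}}
∣T[i,i]∣≡frac n d i j c i≤n∸d j≤n∸d d∸i≡c+j =
  ∣T∣≡frac n d i i j (mersenneProd 0 i) (mersenneProd 0 i) (mersenneProd c j) (mersenneProd 0 j)
    (mersenneProd j K) (mersenneProd 0 K) {{mersenneProd≢0 0 i}} {{mersenneProd≢0 0 j}} {{mersenneProd≢0 0 K}}
    exponent (gauss2≡frac 0 i refl) (gauss2≡frac c j d∸i≡c+j)
    (gauss2≡frac j K (trans (ℕ.m∸n+n≡m i≤n∸d) (sym (ℕ.m+[n∸m]≡n j≤n∸d))))
  where
  K = n ∸ d ∸ j
  exponent : j * (j + i ∸ i) + (i ∸ i) C 2 ≡ j * j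
  exponent rewrite ℕ.m+n∸n≡m j i | ℕ.n∸n≡0 i = ℕ.+-identityʳ (j * j)

∣T[i,i]∣-ratio : ∀ n d i j o → d ≡ i + 1 + o + j → d ≤ n ∸ d → ∀ l m .{{_ : NonZero m}} →
  l * (2 ^ suc o ∸ 1) ≤ m * (2 ^ (suc o + j) ∸ 1) →
  frac l m *ℚ ∣ T n d (i + 1) (i + 1) j ∣ ≤ℚ ∣ T n d i i j ∣
∣T[i,i]∣-ratio n d i j o d≡ d≤n∸d l m ratio =
  subst₂ (λ A B → frac l m *ℚ B ≤ℚ A)
    (sym (∣T[i,i]∣≡frac n d i j (suc o) (ℕ.≤-trans i≤d d≤n∸d) (ℕ.≤-trans j≤d d≤n∸d) d∸i≡))
    (sym (∣T[i,i]∣≡frac n d (i + 1) j o (ℕ.≤-trans i+1≤d d≤n∸d) (ℕ.≤-trans j≤d d≤n∸d) d∸[i+1]≡))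
    (frac-cross-≤ l m (E * (a * (y * G))) (a * (c * D)) (E * (b * (x * G))) (b * (c * D))
      (cancel-common (mersenneProd-ratio l m o j ratio)))
  where
  E = 2 ^ (j * j)
  K = n ∸ d ∸ j
  a = mersenneProd 0 i
  b = mersenneProd 0 (i + 1)
  c = mersenneProd 0 j
  x = mersenneProd o j
  y = mersenneProd (suc o) j
  D = mersenneProd 0 K
  G = mersenneProd j K
  instance
    a*[c*D]≢0 : NonZero (a * (c * D))
    a*[c*D]≢0 = nonZero-*³ a c D {{mersenneProd≢0 0 i}} {{mersenneProd≢0 0 j}} {{mersenneProd≢0 0 K}}
    b*[c*D]≢0 : NonZero (b * (c * D))
    b*[c*D]≢0 = nonZero-*³ b c D {{mersenneProd≢0 0 (i + 1)}} {{mersenneProd≢0 0 j}} {{mersenneProd≢0 0 K}}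
  cancel-common : l * x ≤ m * y → l * (E * (b * (x * G))) * (a * (c * D)) ≤ E * (a * (y * G)) * (m * (b * (c * D)))
  cancel-common lx≤my =
    subst₂ _≤_ (reorder₁ l x E a b G c D) (reorder₂ m y E a b G c D) (ℕ.*-monoˡ-≤ (E * a * b * G * c * D) lx≤my)
    where
    reorder₁ : ∀ l x E a b G c D → l * x * (E * a * b * G * c * D) ≡ l * (E * (b * (x * G))) * (a * (c * D))
    reorder₁ = solve-∀
    reorder₂ : ∀ m y E a b G c D → m * y * (E * a * b * G * c * D) ≡ E * (a * (y * G)) * (m * (b * (c * D)))
    reorder₂ = solve-∀
  i+1≤d : i + 1 ≤ d
  i+1≤d = subst (i + 1 ≤_) (sym d≡) (ℕ.≤-trans (ℕ.m≤m+n (i + 1) o) (ℕ.m≤m+n (i + 1 + o) j))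
  i≤d : i ≤ d
  i≤d = ℕ.≤-trans (ℕ.m≤m+n i 1) i+1≤d
  j≤d : j ≤ d
  j≤d = subst (j ≤_) (sym d≡) (ℕ.m≤n+m j (i + 1 + o))
  d∸i≡ : d ∸ i ≡ suc o + j
  d∸i≡ = m≡k+n⇒m∸n≡k (trans d≡ (reorder i o j))
    where
    reorder : ∀ i o j → i + 1 + o + j ≡ (1 + o + j) + i
    reorder = solve-∀
  d∸[i+1]≡ : d ∸ (i + 1) ≡ o + j
  d∸[i+1]≡ = m≡k+n⇒m∸n≡k (trans d≡ (reorder i o j))
    where
    reorder : ∀ i o j → i + 1 + o + j ≡ (o + j) + (i + 1)
    reorder = solve-∀

-- The case d − j ≤ i, where h = h′ = d − j

-- |T_h(h + a, j)| / |T_h(h + a + 1, j)| = ratioNum / ratioDen, for j = a + 1 + b, d = h + j, n = 2d + 1 + e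
ratioNum : ℕ → ℕ → ℕ → ℕ → ℕ
ratioNum a h b e = 2 ^ suc b * (2 ^ suc a ∸ 1) * (2 ^ (suc b + (h + suc e)) ∸ 1)

ratioDen : ℕ → ℕ → ℕ → ℕ
ratioDen a h b = (2 ^ (suc a + h) ∸ 1) * (2 ^ suc b ∸ 1)

mersenneProd-ratio₂ : ∀ l m a h b e → l * ratioDen a h b ≤ m * ratioNum a h b e →
  let M = h + suc e in
  l * mersenneProd (suc a) h * mersenneProd b M ≤ m * 2 ^ suc b * mersenneProd a h * mersenneProd (suc b) M
mersenneProd-ratio₂ l m a h b e ratio =
  ℕ.*-cancelʳ-≤ (l * x₁ * x₂) (m * Y * y₁ * y₂) (u₁ * u₂) {{ℕ.m*n≢0 u₁ u₂ {{pow2m1-nonzero a}} {{pow2m1-nonzero b}}}} (begin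
  l * x₁ * x₂ * (u₁ * u₂)           ≡⟨ reorder₁ l x₁ x₂ u₁ u₂ ⟩
  l * (x₁ * u₁) * x₂ * u₂           ≡⟨ cong (λ t → l * t * x₂ * u₂) (mersenneProd-shift a h) ⟩
  l * (y₁ * v₁) * x₂ * u₂           ≡⟨ reorder₂ l y₁ v₁ x₂ u₂ ⟩
  y₁ * x₂ * (l * (v₁ * u₂))         ≤⟨ ℕ.*-monoʳ-≤ (y₁ * x₂) ratio ⟩
  y₁ * x₂ * (m * (Y * u₁ * v₂))     ≡⟨ reorder₃ y₁ x₂ m Y u₁ v₂ ⟩
  m * Y * y₁ * (x₂ * v₂) * u₁       ≡⟨ cong (λ t → m * Y * y₁ * t * u₁) (sym (mersenneProd-shift b M)) ⟩
  m * Y * y₁ * (y₂ * u₂) * u₁       ≡⟨ reorder₄ m Y y₁ y₂ u₂ u₁ ⟩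
  m * Y * y₁ * y₂ * (u₁ * u₂)       ∎)
  where
  open ℕ.≤-Reasoning
  M = h + suc e
  Y = 2 ^ suc b
  x₁ = mersenneProd (suc a) h
  x₂ = mersenneProd b M
  y₁ = mersenneProd a h
  y₂ = mersenneProd (suc b) M
  u₁ = 2 ^ suc a ∸ 1
  u₂ = 2 ^ suc b ∸ 1
  v₁ = 2 ^ (suc a + h) ∸ 1
  v₂ = 2 ^ (suc b + M) ∸ 1
  reorder₁ : ∀ l x₁ x₂ u₁ u₂ → l * x₁ * x₂ * (u₁ * u₂) ≡ l * (x₁ * u₁) * x₂ * u₂
  reorder₁ = solve-∀
  reorder₂ : ∀ l y₁ v₁ x₂ u₂ → l * (y₁ * v₁) * x₂ * u₂ ≡ y₁ * x₂ * (l * (v₁ * u₂))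
  reorder₂ = solve-∀
  reorder₃ : ∀ y₁ x₂ m Y u₁ v₂ → y₁ * x₂ * (m * (Y * u₁ * v₂)) ≡ m * Y * y₁ * (x₂ * v₂) * u₁
  reorder₃ = solve-∀
  reorder₄ : ∀ m Y y₁ y₂ u₂ u₁ → m * Y * y₁ * (y₂ * u₂) * u₁ ≡ m * Y * y₁ * y₂ * (u₁ * u₂)
  reorder₄ = solve-∀

2^E₁≡2^E₂*2^[1+b] : ∀ a b → 2 ^ ((a + suc b) * suc b + a C 2) ≡ 2 ^ ((a + suc b) * b + suc a C 2) * 2 ^ suc b
2^E₁≡2^E₂*2^[1+b] a b = trans (cong (2 ^_) exponents) (ℕ.^-distribˡ-+-* 2 ((a + suc b) * b + suc a C 2) (suc b))
  where
  regroup : ∀ a b c → (a + suc b) * suc b + c ≡ (a + suc b) * b + (a + c) + suc b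
  regroup = solve-∀
  pascal : a + a C 2 ≡ suc a C 2
  pascal = trans (cong (_+ a C 2) (sym (nC1≡n a))) (nCk+nC[k+1]≡[n+1]C[k+1] a 1)
  exponents : (a + suc b) * suc b + a C 2 ≡ (a + suc b) * b + suc a C 2 + suc b
  exponents = trans (regroup a b (a C 2)) (cong (λ t → (a + suc b) * b + t + suc b) pascal)

∣T[d∸j]∣≡frac : ∀ n d h i j k r M → i ≡ k + h → j + h ≡ r + i → d ≡ j + h →
  n ∸ d ∸ j ≡ M → n ∸ d ∸ i + h ≡ r + M →
  ∣ T n d h i j ∣ ≡ frac (2 ^ (j * r + k C 2) * (mersenneProd k h * (mersenneProd 0 j * mersenneProd r M)))
                         (mersenneProd 0 h * (mersenneProd 0 j * mersenneProd 0 M))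
                         {{nonZero-*³ _ _ _ {{mersenneProd≢0 0 h}} {{mersenneProd≢0 0 j}} {{mersenneProd≢0 0 M}}}}
∣T[d∸j]∣≡frac n d h i j k r M i≡k+h j+h≡r+i d≡j+h K≡M corner =
  ∣T∣≡frac n d h i j (mersenneProd k h) (mersenneProd 0 h) (mersenneProd 0 j) (mersenneProd 0 j)
    (mersenneProd r M) (mersenneProd 0 M) {{mersenneProd≢0 0 h}} {{mersenneProd≢0 0 j}} {{mersenneProd≢0 0 M}}
    (cong₂ (λ s t → j * s + t C 2) (m≡k+n⇒m∸n≡k j+h≡r+i) (m≡k+n⇒m∸n≡k {n = h} i≡k+h))
    (gauss2≡frac k h i≡k+h) (gauss2≡frac 0 j (m≡k+n⇒m∸n≡k d≡j+h))
    (subst (λ K → gauss2 (n ∸ d ∸ i + h) K ≡ frac (mersenneProd r M) (mersenneProd 0 M) {{mersenneProd≢0 0 M}})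
      (sym K≡M) (gauss2≡frac r M corner))

∣T[d∸j]∣-closed : ∀ h a b e →
  let j = a + suc b
      d = h + j
      n = 2 * d + 1 + e
      M = h + suc e
      Q = mersenneProd 0 h * (mersenneProd 0 j * mersenneProd 0 M)
      instance
        Q≢0 : NonZero Q
        Q≢0 = nonZero-*³ _ _ _ {{mersenneProd≢0 0 h}} {{mersenneProd≢0 0 j}} {{mersenneProd≢0 0 M}}
  in ∣ T n d h (h + a) j ∣ ≡ frac (2 ^ (j * suc b + a C 2) * (mersenneProd a h * (mersenneProd 0 j * mersenneProd (suc b) M))) Q
   × ∣ T n d h (h + a + 1) j ∣ ≡ frac (2 ^ (j * b + suc a C 2) * (mersenneProd (suc a) h * (mersenneProd 0 j * mersenneProd b M))) Q
∣T[d∸j]∣-closed h a b e =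
    ∣T[d∸j]∣≡frac n d h (h + a) j a (suc b) M (ℕ.+-comm h a) (j+h≡[1+b]+i h a b) (ℕ.+-comm h j) K≡M
      (corner (suc b) (h + a) (d+1+e≡[1+b]+1+e+i h a b e))
  , ∣T[d∸j]∣≡frac n d h (h + a + 1) j (suc a) b M (i+1≡[1+a]+h h a) (j+h≡b+[i+1] h a b) (ℕ.+-comm h j) K≡M
      (corner b (h + a + 1) (d+1+e≡b+1+e+[i+1] h a b e))
  where
  2d+1+e≡[d+1+e]+d : ∀ d e → 2 * d + 1 + e ≡ d + 1 + e + d
  2d+1+e≡[d+1+e]+d = solve-∀
  j+h≡[1+b]+i : ∀ h a b → a + suc b + h ≡ suc b + (h + a)
  j+h≡[1+b]+i = solve-∀
  d+1+e≡[1+b]+1+e+i : ∀ h a b e → h + (a + suc b) + 1 + e ≡ suc b + suc e + (h + a)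
  d+1+e≡[1+b]+1+e+i = solve-∀
  i+1≡[1+a]+h : ∀ h a → h + a + 1 ≡ suc a + h
  i+1≡[1+a]+h = solve-∀
  j+h≡b+[i+1] : ∀ h a b → a + suc b + h ≡ b + (h + a + 1)
  j+h≡b+[i+1] = solve-∀
  d+1+e≡b+1+e+[i+1] : ∀ h a b e → h + (a + suc b) + 1 + e ≡ b + suc e + (h + a + 1)
  d+1+e≡b+1+e+[i+1] = solve-∀
  d+1+e≡M+j : ∀ h a b e → h + (a + suc b) + 1 + e ≡ h + suc e + (a + suc b)
  d+1+e≡M+j = solve-∀
  r+1+e+h≡r+M : ∀ r e h → r + suc e + h ≡ r + (h + suc e)
  r+1+e+h≡r+M = solve-∀
  j = a + suc b
  d = h + j
  n = 2 * d + 1 + e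
  M = h + suc e
  n∸d≡d+1+e : n ∸ d ≡ d + 1 + e
  n∸d≡d+1+e = m≡k+n⇒m∸n≡k (2d+1+e≡[d+1+e]+d d e)
  K≡M : n ∸ d ∸ j ≡ M
  K≡M = trans (cong (_∸ j) n∸d≡d+1+e) (m≡k+n⇒m∸n≡k (d+1+e≡M+j h a b e))
  corner : ∀ r x → d + 1 + e ≡ r + suc e + x → n ∸ d ∸ x + h ≡ r + M
  corner r x eq = trans (cong (λ t → t ∸ x + h) n∸d≡d+1+e) (trans (cong (_+ h) (m≡k+n⇒m∸n≡k eq)) (r+1+e+h≡r+M r e h))

∣T[d∸j]∣-ratio : ∀ h a b e l m .{{_ : NonZero m}} → l * ratioDen a h b ≤ m * ratioNum a h b e →
  let j = a + suc b
      d = h + j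
      n = 2 * d + 1 + e
  in frac l m *ℚ ∣ T n d h (h + a + 1) j ∣ ≤ℚ ∣ T n d h (h + a) j ∣
∣T[d∸j]∣-ratio h a b e l m ratio =
  subst₂ (λ A B → frac l m *ℚ B ≤ℚ A) (sym (proj₁ (∣T[d∸j]∣-closed h a b e))) (sym (proj₂ (∣T[d∸j]∣-closed h a b e)))
    (frac-cross-≤ l m (2 ^ E₁ * P) Q (2 ^ E₂ * P′) Q
      (subst (λ t → l * (2 ^ E₂ * P′) * Q ≤ t * P * (m * Q)) (sym (2^E₁≡2^E₂*2^[1+b] a b))
        (cancel-common (mersenneProd-ratio₂ l m a h b e ratio))))
  where
  j = a + suc b
  M = h + suc e
  E₁ = j * suc b + a C 2
  E₂ = j * b + suc a C 2
  c = mersenneProd 0 j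
  y₁ = mersenneProd a h
  y₂ = mersenneProd (suc b) M
  x₁ = mersenneProd (suc a) h
  x₂ = mersenneProd b M
  P = y₁ * (c * y₂)
  P′ = x₁ * (c * x₂)
  Q = mersenneProd 0 h * (c * mersenneProd 0 M)
  instance
    Q≢0 : NonZero Q
    Q≢0 = nonZero-*³ _ _ _ {{mersenneProd≢0 0 h}} {{mersenneProd≢0 0 j}} {{mersenneProd≢0 0 M}}
  cancel-common : l * x₁ * x₂ ≤ m * 2 ^ suc b * y₁ * y₂ → l * (2 ^ E₂ * P′) * Q ≤ 2 ^ E₂ * 2 ^ suc b * P * (m * Q)
  cancel-common lx≤my = subst₂ _≤_ (reorder₁ l (2 ^ E₂) x₁ x₂ c Q) (reorder₂ m (2 ^ E₂) (2 ^ suc b) y₁ y₂ c Q)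
    (ℕ.*-monoˡ-≤ (2 ^ E₂ * c * Q) lx≤my)
    where
    reorder₁ : ∀ l E x₁ x₂ c Q → l * x₁ * x₂ * (E * c * Q) ≡ l * (E * (x₁ * (c * x₂))) * Q
    reorder₁ = solve-∀
    reorder₂ : ∀ m E Y y₁ y₂ c Q → m * Y * y₁ * y₂ * (E * c * Q) ≡ E * Y * (y₁ * (c * y₂)) * (m * Q)
    reorder₂ = solve-∀

2^q*[2^p∸1]≤2^[p+q]∸1 : ∀ p q → 2 ^ q * (2 ^ p ∸ 1) ≤ 2 ^ (p + q) ∸ 1
2^q*[2^p∸1]≤2^[p+q]∸1 p q = begin
  2 ^ q * (2 ^ p ∸ 1)       ≡⟨ ℕ.*-distribˡ-∸ (2 ^ q) (2 ^ p) 1 ⟩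
  2 ^ q * 2 ^ p ∸ 2 ^ q * 1 ≡⟨ cong₂ _∸_ (trans (ℕ.*-comm (2 ^ q) (2 ^ p)) (sym (ℕ.^-distribˡ-+-* 2 p q))) (ℕ.*-identityʳ (2 ^ q)) ⟩
  2 ^ (p + q) ∸ 2 ^ q       ≤⟨ ℕ.∸-monoʳ-≤ (2 ^ (p + q)) (ℕ.m^n>0 2 q) ⟩
  2 ^ (p + q) ∸ 1           ∎
  where open ℕ.≤-Reasoning

ratio[h≡i]≥3 : ∀ o j → 2 ≤ j → 3 * (2 ^ suc o ∸ 1) ≤ 1 * (2 ^ (suc o + j) ∸ 1)
ratio[h≡i]≥3 o j 2≤j = begin
  3 * (2 ^ suc o ∸ 1)     ≤⟨ ℕ.*-monoˡ-≤ (2 ^ suc o ∸ 1) (ℕ.≤-trans (ℕ.n≤1+n 3) (ℕ.^-monoʳ-≤ 2 2≤j)) ⟩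
  2 ^ j * (2 ^ suc o ∸ 1) ≤⟨ 2^q*[2^p∸1]≤2^[p+q]∸1 (suc o) j ⟩
  2 ^ (suc o + j) ∸ 1     ≡⟨ ℕ.*-identityˡ (2 ^ (suc o + j) ∸ 1) ⟨
  1 * (2 ^ (suc o + j) ∸ 1) ∎
  where open ℕ.≤-Reasoning

ratio[h≡i]≥3/2 : ∀ o → 3 * (2 ^ suc o ∸ 1) ≤ 2 * (2 ^ (suc o + 1) ∸ 1)
ratio[h≡i]≥3/2 o = begin
  3 * (2 ^ suc o ∸ 1)       ≤⟨ ℕ.*-monoˡ-≤ (2 ^ suc o ∸ 1) (ℕ.n≤1+n 3) ⟩
  4 * (2 ^ suc o ∸ 1)       ≡⟨ ℕ.*-assoc 2 2 (2 ^ suc o ∸ 1) ⟩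
  2 * (2 * (2 ^ suc o ∸ 1)) ≤⟨ ℕ.*-monoʳ-≤ 2 (2^q*[2^p∸1]≤2^[p+q]∸1 (suc o) 1) ⟩
  2 * (2 ^ (suc o + 1) ∸ 1) ∎
  where open ℕ.≤-Reasoning

≤-by-difference : ∀ {a b} k → a + k ≡ b → a ≤ b
≤-by-difference {a} k refl = ℕ.m≤m+n a k

1+m∸1≡m : ∀ {n} m → n ≡ suc m → n ∸ 1 ≡ m
1+m∸1≡m m refl = refl

-- X = 2^(1+a), Y = 2^(1+b), Z = 2^h, W = 2^(1+e) in ratioNum a h b (1 + e) / ratioDen a h b
ratio-poly≥3 : ∀ {X Y Z W} → 2 ≤ X → 2 ≤ Y → 1 ≤ Z → 2 ≤ W →
  3 * ((X * Z ∸ 1) * (Y ∸ 1)) ≤ 1 * (Y * (X ∸ 1) * (Y * (Z * (2 * W)) ∸ 1))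
ratio-poly≥3 {suc (suc x)} {suc (suc y)} {suc z} {suc (suc w)} (s≤s (s≤s z≤n)) (s≤s (s≤s z≤n)) (s≤s z≤n) (s≤s (s≤s z≤n)) =
  subst₂ (λ s t → 3 * (s * (1 + y)) ≤ 1 * ((2 + y) * (1 + x) * t))
    (sym (1+m∸1≡m (1 + x + x * z + 2 * z) (XZ x z)))
    (sym (1+m∸1≡m N (YZ2W y z w)))
    (≤-by-difference D (difference x y z w))
  where
  N = 7 + 4 * w + 2 * w * y + 2 * w * y * z + 4 * w * z + 4 * y + 4 * y * z + 8 * z
  D = 11 + 8 * w + 8 * w * x + 8 * w * x * y + 8 * w * x * y * z + 2 * w * x * y * y + 2 * w * x * y * y * z
      + 8 * w * x * z + 8 * w * y + 8 * w * y * z + 2 * w * y * y + 2 * w * y * y * z + 8 * w * z + 11 * x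
      + 12 * x * y + 13 * x * y * z + 4 * x * y * y + 4 * x * y * y * z + 13 * x * z + 12 * y + 10 * y * z
      + 4 * y * y + 4 * y * y * z + 10 * z
  XZ : ∀ x z → (2 + x) * (1 + z) ≡ 1 + (1 + x + x * z + 2 * z)
  XZ = solve-∀
  YZ2W : ∀ y z w → (2 + y) * ((1 + z) * (2 * (2 + w))) ≡ 1 + (7 + 4 * w + 2 * w * y + 2 * w * y * z + 4 * w * z + 4 * y + 4 * y * z + 8 * z)
  YZ2W = solve-∀
  difference : ∀ x y z w →
    3 * ((1 + x + x * z + 2 * z) * (1 + y))
      + (11 + 8 * w + 8 * w * x + 8 * w * x * y + 8 * w * x * y * z + 2 * w * x * y * y + 2 * w * x * y * y * z
      + 8 * w * x * z + 8 * w * y + 8 * w * y * z + 2 * w * y * y + 2 * w * y * y * z + 8 * w * z + 11 * x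
      + 12 * x * y + 13 * x * y * z + 4 * x * y * y + 4 * x * y * y * z + 13 * x * z + 12 * y + 10 * y * z
      + 4 * y * y + 4 * y * y * z + 10 * z)
    ≡ 1 * ((2 + y) * (1 + x) * (7 + 4 * w + 2 * w * y + 2 * w * y * z + 4 * w * z + 4 * y + 4 * y * z + 8 * z))
  difference = solve-∀

-- X = 2^(2+a), Y = 2^(1+b), Z = 2^h in ratioNum (1 + a) h b 0 / ratioDen (1 + a) h b; equality at X = 4, Y = 2, Z = 1
ratio-poly≥6 : ∀ {X Y Z} → 4 ≤ X → 2 ≤ Y → 1 ≤ Z →
  6 * ((X * Z ∸ 1) * (Y ∸ 1)) ≤ 1 * (Y * (X ∸ 1) * (Y * (Z * (2 * 1)) ∸ 1))
ratio-poly≥6 {suc (suc (suc (suc x)))} {suc (suc y)} {suc z} (s≤s (s≤s (s≤s (s≤s z≤n)))) (s≤s (s≤s z≤n)) (s≤s z≤n) =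
  subst₂ (λ s t → 6 * (s * (1 + y)) ≤ 1 * ((2 + y) * (3 + x) * t))
    (sym (1+m∸1≡m (3 + x + x * z + 4 * z) (XZ x z)))
    (sym (1+m∸1≡m (3 + 2 * y + 2 * y * z + 4 * z) (YZ2 y z)))
    (≤-by-difference _ (difference x y z))
  where
  XZ : ∀ x z → (4 + x) * (1 + z) ≡ 1 + (3 + x + x * z + 4 * z)
  XZ = solve-∀
  YZ2 : ∀ y z → (2 + y) * ((1 + z) * (2 * 1)) ≡ 1 + (3 + 2 * y + 2 * y * z + 4 * z)
  YZ2 = solve-∀
  difference : ∀ x y z →
    6 * ((3 + x + x * z + 4 * z) * (1 + y))
      + (x * y + 2 * x * y * z + 2 * x * y * y + 2 * x * y * y * z + 2 * x * z + 3 * y + 6 * y * y + 6 * y * y * z)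
    ≡ 1 * ((2 + y) * (3 + x) * (3 + 2 * y + 2 * y * z + 4 * z))
  difference = solve-∀

2≤2^[1+k] : ∀ k → 2 ≤ 2 ^ suc k
2≤2^[1+k] k = ℕ.^-monoʳ-≤ 2 {1} {suc k} (s≤s z≤n)

2^[1+b+[h+c]]≡ : ∀ b h c → 2 ^ (suc b + (h + c)) ≡ 2 ^ suc b * (2 ^ h * 2 ^ c)
2^[1+b+[h+c]]≡ b h c = trans (ℕ.^-distribˡ-+-* 2 (suc b) (h + c)) (cong (2 ^ suc b *_) (ℕ.^-distribˡ-+-* 2 h c))

ratio[d∸j]≥3 : ∀ a h b e → 3 * ratioDen a h b ≤ 1 * ratioNum a h b (suc e)
ratio[d∸j]≥3 a h b e =
  subst₂ (λ s t → 3 * ((s ∸ 1) * (2 ^ suc b ∸ 1)) ≤ 1 * (2 ^ suc b * (2 ^ suc a ∸ 1) * (t ∸ 1)))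
    (sym (ℕ.^-distribˡ-+-* 2 (suc a) h)) (sym (2^[1+b+[h+c]]≡ b h (suc (suc e))))
    (ratio-poly≥3 (2≤2^[1+k] a) (2≤2^[1+k] b) (ℕ.m^n>0 2 h) (2≤2^[1+k] e))

ratio[d∸j]≥3/2 : ∀ a h b e → 3 * ratioDen a h b ≤ 2 * ratioNum a h b (suc e)
ratio[d∸j]≥3/2 a h b e = ℕ.≤-trans (ratio[d∸j]≥3 a h b e) (ℕ.*-monoˡ-≤ (ratioNum a h b (suc e)) (ℕ.n≤1+n 1))

ratio[d∸j]≥6 : ∀ a h b → 6 * ratioDen (suc a) h b ≤ 1 * ratioNum (suc a) h b 0
ratio[d∸j]≥6 a h b =
  subst₂ (λ s t → 6 * ((s ∸ 1) * (2 ^ suc b ∸ 1)) ≤ 1 * (2 ^ suc b * (2 ^ suc (suc a) ∸ 1) * (t ∸ 1)))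
    (sym (ℕ.^-distribˡ-+-* 2 (suc (suc a)) h)) (sym (2^[1+b+[h+c]]≡ b h 1))
    (ratio-poly≥6 (ℕ.^-monoʳ-≤ 2 {2} {suc (suc a)} (s≤s (s≤s z≤n))) (2≤2^[1+k] b) (ℕ.m^n>0 2 h))

ratio[d∸j]≥lIV : ∀ h b → let d = h + suc b in
  2 ^ suc b * (2 ^ (d + 1) ∸ 1) * 1 * ratioDen 0 h b ≤ (2 ^ suc b ∸ 1) * (2 ^ suc (d ∸ suc b) ∸ 1) * ratioNum 0 h b 0
ratio[d∸j]≥lIV h b =
  subst₂ (λ s t → 2 ^ suc b * (2 ^ t ∸ 1) * 1 * ratioDen 0 h b ≤ (2 ^ suc b ∸ 1) * (2 ^ suc s ∸ 1) * ratioNum 0 h b 0)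
    (sym (ℕ.m+n∸n≡m h (suc b))) (sym (d+1≡ h b))
    (ℕ.≤-reflexive (reorder (2 ^ suc b) (2 ^ (suc b + (h + 1)) ∸ 1) (2 ^ suc h ∸ 1) (2 ^ suc b ∸ 1)))
  where
  d+1≡ : ∀ h b → h + suc b + 1 ≡ suc b + (h + 1)
  d+1≡ = solve-∀
  reorder : ∀ Y V S U → Y * V * 1 * (S * U) ≡ U * S * (Y * 1 * V)
  reorder = solve-∀

Bounds : (d n i j : ℕ) → Set
Bounds d n i j =
  let h = i ⊓ (d ∸ j)
      h′ = (i + 1) ⊓ (d ∸ j)
      A = ∣ T n d h i j ∣
      B = ∣ T n d h′ (i + 1) j ∣
  in (((n ≢ 2 * d + 1) ⊎ (h ≢ d ∸ j)) → 2 ≤ j → (+ 3 / 1) *ℚ B ≤ℚ A)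
   × (((n ≢ 2 * d + 1) ⊎ (h ≢ d ∸ j)) → j ≡ 1 → (+ 3 / 2) *ℚ B ≤ℚ A)
   × (n ≡ 2 * d + 1 → d ∸ j < i → (+ 6 / 1) *ℚ B ≤ℚ A)
   × (n ≡ 2 * d + 1 → d ∸ j ≡ i → lIV d j *ℚ B ≤ℚ A)

bounds[h≡i] : ∀ d n i j o → d ≡ i + 1 + o + j → d ≤ n ∸ d → Bounds d n i j
bounds[h≡i] d n i j o d≡ d≤n∸d =
    (λ _ 2≤j → with-h {3} {1} (∣T[i,i]∣-ratio n d i j o d≡ d≤n∸d 3 1 (ratio[h≡i]≥3 o j 2≤j)))
  , (λ { _ refl → with-h {3} {2} (∣T[i,i]∣-ratio n d i 1 o d≡ d≤n∸d 3 2 (ratio[h≡i]≥3/2 o)) })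
  , (λ _ d∸j<i → ⊥-elim (ℕ.n≮n i (ℕ.≤-<-trans i≤d∸j d∸j<i)))
  , (λ _ d∸j≡i → ⊥-elim (ℕ.m≢1+m+n i (trans (sym d∸j≡i) (trans d∸j≡ (i+1+o≡1+i+o i o)))))
  where
  d∸j≡ : d ∸ j ≡ i + 1 + o
  d∸j≡ = m≡k+n⇒m∸n≡k d≡
  i≤d∸j : i ≤ d ∸ j
  i≤d∸j = subst (i ≤_) (sym d∸j≡) (ℕ.≤-trans (ℕ.m≤m+n i 1) (ℕ.m≤m+n (i + 1) o))
  i+1+o≡1+i+o : ∀ i o → i + 1 + o ≡ suc (i + o)
  i+1+o≡1+i+o = solve-∀
  with-h : ∀ {l m} .{{_ : NonZero m}} →
    frac l m *ℚ ∣ T n d (i + 1) (i + 1) j ∣ ≤ℚ ∣ T n d i i j ∣ →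
    frac l m *ℚ ∣ T n d ((i + 1) ⊓ (d ∸ j)) (i + 1) j ∣ ≤ℚ ∣ T n d (i ⊓ (d ∸ j)) i j ∣
  with-h {l} {m} = subst₂ (λ h h′ → frac l m *ℚ ∣ T n d h′ (i + 1) j ∣ ≤ℚ ∣ T n d h i j ∣)
    (sym (ℕ.m≤n⇒m⊓n≡m i≤d∸j)) (sym (ℕ.m≤n⇒m⊓n≡m (subst (i + 1 ≤_) (sym d∸j≡) (ℕ.m≤m+n (i + 1) o))))

module _ (h a b e : ℕ) where
  private
    j = a + suc b
    d = h + j
    n = 2 * d + 1 + e

  d∸j≡h : d ∸ j ≡ h
  d∸j≡h = m≡k+n⇒m∸n≡k {n = j} refl

  ⊓[d∸j]≡h : ∀ k → (h + k) ⊓ (d ∸ j) ≡ h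
  ⊓[d∸j]≡h k = trans (cong ((h + k) ⊓_) d∸j≡h) (ℕ.m≥n⇒m⊓n≡n (ℕ.m≤m+n h k))

  ratio[d∸j]-at-h : ∀ l m .{{_ : NonZero m}} → l * ratioDen a h b ≤ m * ratioNum a h b e →
    frac l m *ℚ ∣ T n d ((h + a + 1) ⊓ (d ∸ j)) (h + a + 1) j ∣ ≤ℚ ∣ T n d ((h + a) ⊓ (d ∸ j)) (h + a) j ∣
  ratio[d∸j]-at-h l m ratio =
    subst₂ (λ h₁ h₂ → frac l m *ℚ ∣ T n d h₂ (h + a + 1) j ∣ ≤ℚ ∣ T n d h₁ (h + a) j ∣)
      (sym (⊓[d∸j]≡h a)) (trans (sym (⊓[d∸j]≡h (a + 1))) (cong (_⊓ (d ∸ j)) (sym (ℕ.+-assoc h a 1))))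
      (∣T[d∸j]∣-ratio h a b e l m ratio)

bounds[h≡d∸j] : ∀ h a b e → Bounds (h + (a + suc b)) (2 * (h + (a + suc b)) + 1 + e) (h + a) (a + suc b)
bounds[h≡d∸j] h a b (suc e) =
    (λ _ _ → ratio[d∸j]-at-h h a b (suc e) 3 1 (ratio[d∸j]≥3 a h b e))
  , (λ _ _ → ratio[d∸j]-at-h h a b (suc e) 3 2 (ratio[d∸j]≥3/2 a h b e))
  , (λ n≡ _ → ⊥-elim (n≢ n≡))
  , (λ n≡ _ → ⊥-elim (n≢ n≡))
  where
  n≢ : ∀ {m} → m + suc e ≢ m
  n≢ {m} eq = ℕ.m≢1+m+n m (trans (sym eq) (ℕ.+-suc m e))
bounds[h≡d∸j] h zero b zero =
    (λ { (inj₁ n≢) _ → ⊥-elim (n≢ (ℕ.+-identityʳ _)) ; (inj₂ h≢) _ → ⊥-elim (h≢ h≡d∸j) })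
  , (λ { (inj₁ n≢) _ → ⊥-elim (n≢ (ℕ.+-identityʳ _)) ; (inj₂ h≢) _ → ⊥-elim (h≢ h≡d∸j) })
  , (λ _ d∸j<h → ⊥-elim (ℕ.n≮n h (subst₂ _<_ (d∸j≡h h 0 b 0) (ℕ.+-identityʳ h) d∸j<h)))
  , (λ _ _ → subst (λ l → l *ℚ ∣ T n d ((h + 0 + 1) ⊓ (d ∸ suc b)) (h + 0 + 1) (suc b) ∣ ≤ℚ ∣ T n d ((h + 0) ⊓ (d ∸ suc b)) (h + 0) (suc b) ∣)
      (sym lIV≡)
      (ratio[d∸j]-at-h h 0 b 0 (2 ^ suc b * (2 ^ (d + 1) ∸ 1) * 1) ((2 ^ suc b ∸ 1) * (2 ^ suc (d ∸ suc b) ∸ 1))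
        {{ℕ.m*n≢0 _ _ {{pow2m1-nonzero b}} {{pow2m1-nonzero (d ∸ suc b)}}}} (ratio[d∸j]≥lIV h b)))
  where
  d = h + suc b
  n = 2 * d + 1 + 0
  h≡d∸j : (h + 0) ⊓ (d ∸ suc b) ≡ d ∸ suc b
  h≡d∸j = trans (⊓[d∸j]≡h h 0 b 0 0) (sym (d∸j≡h h 0 b 0))
  lIV≡ : lIV d (suc b) ≡ frac (2 ^ suc b * (2 ^ (d + 1) ∸ 1) * 1) ((2 ^ suc b ∸ 1) * (2 ^ suc (d ∸ suc b) ∸ 1))
                              {{ℕ.m*n≢0 _ _ {{pow2m1-nonzero b}} {{pow2m1-nonzero (d ∸ suc b)}}}}
  lIV≡ = frac-* (2 ^ suc b * (2 ^ (d + 1) ∸ 1)) (2 ^ suc b ∸ 1) 1 (2 ^ suc (d ∸ suc b) ∸ 1) {{pow2m1-nonzero b}} {{pow2m1-nonzero (d ∸ suc b)}}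
bounds[h≡d∸j] h (suc a) b zero =
    (λ { (inj₁ n≢) _ → ⊥-elim (n≢ (ℕ.+-identityʳ _)) ; (inj₂ h≢) _ → ⊥-elim (h≢ h≡d∸j) })
  , (λ { (inj₁ n≢) _ → ⊥-elim (n≢ (ℕ.+-identityʳ _)) ; (inj₂ h≢) _ → ⊥-elim (h≢ h≡d∸j) })
  , (λ _ _ → ratio[d∸j]-at-h h (suc a) b 0 6 1 (ratio[d∸j]≥6 a h b))
  , (λ _ d∸j≡i → ⊥-elim (ℕ.m≢1+m+n h (trans (sym (d∸j≡h h (suc a) b 0)) (trans d∸j≡i (ℕ.+-suc h a)))))
  where
  h≡d∸j : (h + suc a) ⊓ (h + (suc a + suc b) ∸ (suc a + suc b)) ≡ h + (suc a + suc b) ∸ (suc a + suc b)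
  h≡d∸j = trans (⊓[d∸j]≡h h (suc a) b 0 (suc a)) (sym (d∸j≡h h (suc a) b 0))

bounds-reindexed : ∀ {d n i j} h a b e → i ≡ h + a → j ≡ a + suc b → d ≡ h + j → n ≡ 2 * d + 1 + e → Bounds d n i j
bounds-reindexed h a b e refl refl refl refl = bounds[h≡d∸j] h a b e

d≤n∸d : ∀ {d n} → 2 * d + 1 ≤ n → d ≤ n ∸ d
d≤n∸d {d} {n} 2d+1≤n = begin
  d               ≤⟨ ℕ.m≤m+n d 1 ⟩
  d + 1           ≡⟨ m≡k+n⇒m∸n≡k (reorder d) ⟨
  2 * d + 1 ∸ d   ≤⟨ ℕ.∸-monoˡ-≤ d 2d+1≤n ⟩
  n ∸ d           ∎
  where
  open ℕ.≤-Reasoning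
  reorder : ∀ d → 2 * d + 1 ≡ d + 1 + d
  reorder = solve-∀

bounds[i<d∸j] : ∀ {d n i j} → 2 * d + 1 ≤ n → j ≤ d → i + 1 ≤ d ∸ j → Bounds d n i j
bounds[i<d∸j] {d} {n} {i} {j} 2d+1≤n j≤d i+1≤d∸j =
  let o , i+1+o≡d∸j = ℕ.m≤n⇒∃[o]m+o≡n i+1≤d∸j
  in bounds[h≡i] d n i j o (trans (sym (ℕ.m∸n+n≡m j≤d)) (cong (_+ j) (sym i+1+o≡d∸j))) (d≤n∸d 2d+1≤n)

bounds[d∸j≤i] : ∀ {d n i j} → 2 * d + 1 ≤ n → i + 1 ≤ d → j ≤ d → d ∸ j ≤ i → Bounds d n i j
bounds[d∸j≤i] {d} {n} {i} {j} 2d+1≤n i+1≤d j≤d d∸j≤i =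
  bounds-reindexed h a b e (sym h+a≡i) (sym a+1+b≡j) (sym (ℕ.m∸n+n≡m j≤d)) (sym (proj₂ (ℕ.m≤n⇒∃[o]m+o≡n 2d+1≤n)))
  where
  h = d ∸ j
  a = proj₁ (ℕ.m≤n⇒∃[o]m+o≡n d∸j≤i)
  h+a≡i : h + a ≡ i
  h+a≡i = proj₂ (ℕ.m≤n⇒∃[o]m+o≡n d∸j≤i)
  i+1≡h+1+a : i + 1 ≡ h + suc a
  i+1≡h+1+a = trans (cong (_+ 1) (sym h+a≡i)) (trans (ℕ.+-assoc h a 1) (cong (λ t → h + t) (ℕ.+-comm a 1)))
  1+a≤j : suc a ≤ j
  1+a≤j = ℕ.+-cancelˡ-≤ h (suc a) j (subst₂ _≤_ i+1≡h+1+a (sym (ℕ.m∸n+n≡m j≤d)) i+1≤d)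
  b = proj₁ (ℕ.m≤n⇒∃[o]m+o≡n 1+a≤j)
  a+1+b≡j : a + suc b ≡ j
  a+1+b≡j = trans (ℕ.+-suc a b) (proj₂ (ℕ.m≤n⇒∃[o]m+o≡n 1+a≤j))
  e = proj₁ (ℕ.m≤n⇒∃[o]m+o≡n 2d+1≤n)

lemma3p6 : (d n i j : ℕ) → 1 ≤ d → 2 * d + 1 ≤ n → i ≤ d ∸ 1 → 1 ≤ j → j ≤ d →
    let h = i ⊓ (d ∸ j)
        h′ = (i + 1) ⊓ (d ∸ j)
        A = ∣ T n d h i j ∣
        B = ∣ T n d h′ (i + 1) j ∣
    in (((n ≢ 2 * d + 1) ⊎ (h ≢ d ∸ j)) → 2 ≤ j → (+ 3 / 1) *ℚ B ≤ℚ A)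
     × (((n ≢ 2 * d + 1) ⊎ (h ≢ d ∸ j)) → j ≡ 1 → (+ 3 / 2) *ℚ B ≤ℚ A)
     × (n ≡ 2 * d + 1 → d ∸ j < i → (+ 6 / 1) *ℚ B ≤ℚ A)
     × (n ≡ 2 * d + 1 → d ∸ j ≡ i → lIV d j *ℚ B ≤ℚ A)
lemma3p6 d n i j 1≤d 2d+1≤n i≤d∸1 _ j≤d with i + 1 ≤? d ∸ j
... | yes i+1≤d∸j = bounds[i<d∸j] 2d+1≤n j≤d i+1≤d∸j
... | no i+1≰d∸j = bounds[d∸j≤i] 2d+1≤n i+1≤d j≤d (ℕ.m<1+n⇒m≤n (subst (d ∸ j <_) (ℕ.+-comm i 1) (ℕ.≰⇒> i+1≰d∸j)))
  where
  i+1≤d : i + 1 ≤ d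
  i+1≤d = subst (i + 1 ≤_) (ℕ.m∸n+n≡m 1≤d) (ℕ.+-monoˡ-≤ 1 i≤d∸1)
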